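{- For every permutation $\pi$, $rd(\pi)\le rd(peg(\pi))$.
   Context: Permutations are in one-line notation. A reversal of a permutation replaces a factor $\pi_i\cdots\pi_j$ by $\pi_j\cdots\pi_i$; $rd(\pi)$ is the minimum number of reversals sorting $\pi$ to the identity. A peg permutation of length $n$ is a word $\pi_1^{\varepsilon_1}\cdots\pi_n^{\varepsilon_n}$ with $\pi_1\cdots\pi_n$ a permutation of $\{1,\dots,n\}$ and $\varepsilon_i\in\{+,-,\bullet\}$; a reversal of a peg permutation reverses a factor and swaps $+\leftrightarrow-$ on the reversed entries ($\bullet$ unchanged), and $rd$ of a peg permutation is the minimum number of such reversals turning it into a peg permutation with identity underlying permutation and all decorations in $\{+,\bullet\}$. For a permutation $\pi$, its strips are the maximal factors of consecutive positions whose values increase by $1$ at each step or decrease by $1$ at each step; $peg(\pi)$ is obtained by replacing each strip by a single entry (its minimum value) decorated $+$ for an increasing strip of length $\ge2$, $-$ for a decreasing strip of length $\ge2$, $\bullet$ for a strip of length $1$, and then standardizing the values (e.g. $peg(32451678)=2^-3^+1^\bullet4^+$). -}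

module Defs where

open import Data.Nat using (ℕ; zero; suc; _<_; _≤_; _∸_; _<?_; _⊓_)
open import Data.List using (List; []; _∷_; _++_; map; take; drop; reverse; length; filter; upTo; foldr)
open import Data.List.Relation.Unary.All using (All)
open import Data.Product using (_×_; _,_; proj₁; proj₂; ∃-syntax)
open import Relation.Binary.PropositionalEquality using (_≡_; _≢_)
open import Data.Bool using (Bool; true; false; _∧_; _∨_)
open import Relation.Nullary.Decidable using (⌊_⌋)
open import Data.Nat using (_≡ᵇ_; _<ᵇ_)

ident : ℕ → List ℕ
ident n = map suc (upTo n)

-- Reverse the factor at positions i+1 .. j (0-based: indices i .. j-1),
-- applying f to each reversed entry.
revSeg : {A : Set} → (A → A) → ℕ → ℕ → List A → List A
revSeg f i j xs = take i xs ++ reverse (map f (take (j ∸ i) (drop i xs))) ++ drop j xs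

Rev : List ℕ → List ℕ → Set
Rev xs ys = ∃[ i ] ∃[ j ] (i ≤ j × j ≤ length xs × ys ≡ revSeg (λ x → x) i j xs)

data RdLe : ℕ → List ℕ → Set where
  done : ∀ {k xs} → xs ≡ ident (length xs) → RdLe k xs
  step : ∀ {k xs ys} → Rev xs ys → RdLe k ys → RdLe (suc k) xs

data Deco : Set where
  plus minus dot : Deco

flipD : Deco → Deco
flipD plus  = minus
flipD minus = plus
flipD dot   = dot

Peg : Set
Peg = List (ℕ × Deco)

flipE : ℕ × Deco → ℕ × Deco
flipE (v , d) = (v , flipD d)

PegRev : Peg → Peg → Set
PegRev xs ys = ∃[ i ] ∃[ j ] (i ≤ j × j ≤ length xs × ys ≡ revSeg flipE i j xs)

PegSorted : Peg → Set
PegSorted xs = map proj₁ xs ≡ ident (length xs) × All (λ e → proj₂ e ≢ minus) xs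

data PegRdLe : ℕ → Peg → Set where
  done : ∀ {k xs} → PegSorted xs → PegRdLe k xs
  step : ∀ {k xs ys} → PegRev xs ys → PegRdLe k ys → PegRdLe (suc k) xs

extends : ℕ → List ℕ → Bool
extends x []            = false
extends x (y ∷ [])      = (suc x ≡ᵇ y) ∨ (x ≡ᵇ suc y)
extends x (y ∷ z ∷ _)   = ((suc x ≡ᵇ y) ∧ (suc y ≡ᵇ z)) ∨ ((x ≡ᵇ suc y) ∧ (y ≡ᵇ suc z))

strips : List ℕ → List (List ℕ)
strips [] = []
strips (x ∷ xs) with strips xs
... | [] = (x ∷ []) ∷ []
... | s ∷ ss with extends x s
...   | true  = (x ∷ s) ∷ ss
...   | false = (x ∷ []) ∷ s ∷ ss

minL : ℕ → List ℕ → ℕ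
minL x xs = foldr _⊓_ x xs

stripInfo : List ℕ → ℕ × Deco
stripInfo []           = (0 , dot)
stripInfo (x ∷ [])     = (x , dot)
stripInfo (x ∷ y ∷ ys) with x <ᵇ y
... | true  = (minL x (y ∷ ys) , plus)
... | false = (minL x (y ∷ ys) , minus)

rank : List ℕ → ℕ → ℕ
rank vs v = suc (length (filter (_<? v) vs))

standardize : Peg → Peg
standardize es = map (λ e → (rank (map proj₁ es) (proj₁ e) , proj₂ e)) es

peg : List ℕ → Peg
peg π = standardize (map stripInfo (strips π))

-- Every strip of π is a run of consecutive values, ascending or descending, and peg π lists the
-- runs in order, each as the standardized minimum of the run decorated with its direction. A peg
-- reversal of the entries i..j is mirrored by one reversal of π, of the factor covered by the
-- corresponding runs: it reverses their order and each run, just as it flips + and −. Along a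
-- sorting sequence for peg π the factors thus stay runs. At the end they are ascending (no −),
-- ordered by their minima (the values read 1 2 … m) and pairwise disjoint (π is a permutation),
-- so their concatenation is sorted and hence the identity.
module Submission where

open import Defs
open import Function using (_∘_; _on_; id; Equivalence)
open import Data.Bool using (true; false; T; _∧_)
open import Data.Bool.Properties using (T-∨; T-∧; T-≡)
open import Data.Empty using (⊥; ⊥-elim)
open import Data.Maybe using (just)
open import Data.Maybe.Relation.Binary.Connected using (Connected)
import Data.Maybe.Relation.Binary.Connected as Connected
open import Data.Nat using (ℕ; zero; suc; z≤n; s≤s; _+_; _∸_; _≤_; _<_; _⊓_; _<ᵇ_; _≡ᵇ_; _<?_)
open import Data.Nat.Properties
  using ( ≤-refl; ≤-antisym; <-≤-trans; <⇒≤; ≰⇒>; <⇒≱; ≮⇒≥; n≤1+n; n<1+n; m≤m+n; m≤n+m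
        ; m≢1+n+m; +-suc; +-comm; +-monoʳ-≤; suc-injective; m+n∸m≡n; m+[n∸m]≡n; m∸n+n≡m
        ; m≤n+o⇒m∸n≤o; ⊓-glb; m≤n⇒m⊓o≤n; m≤n⇒o⊓m≤n; ≡ᵇ⇒≡; ≤-totalOrder )
open import Data.List
  using ( List; []; _∷_; [_]; _++_; map; take; drop; reverse; concat; length; foldr; head; last
        ; upTo; applyUpTo; applyDownFrom )
open import Data.List.Properties
  using ( map-++; map-∘; map-cong; map-id; take-map; drop-map; drop-drop; take++drop≡id
        ; concat-++; ++-identityʳ; reverse-++; unfold-reverse; reverse-map; reverse-applyUpTo
        ; reverse-applyDownFrom; length-++; length-map; length-upTo; foldr-preservesᵇ; foldr-preservesᵒ )
open import Data.List.Membership.Propositional using (_∈_)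
open import Data.List.Membership.Propositional.Properties using (∈-applyUpTo⁺; ∈-applyDownFrom⁺)
open import Data.List.Relation.Unary.All using (All; []; _∷_)
import Data.List.Relation.Unary.All as All
import Data.List.Relation.Unary.All.Properties as All
open import Data.List.Relation.Unary.Any using (Any; here; there)
import Data.List.Relation.Unary.Any as Any
open import Data.List.Relation.Unary.AllPairs using (_∷_)
open import Data.List.Relation.Unary.Linked using (Linked; []; _∷_)
import Data.List.Relation.Unary.Linked as Linked
import Data.List.Relation.Unary.Linked.Properties as Linked
open import Data.List.Relation.Unary.Unique.Propositional using (Unique)
import Data.List.Relation.Unary.Unique.Propositional.Properties as Unique
open import Data.List.Relation.Unary.Sorted.TotalOrder.Properties using (↗↭↗⇒≋)
open import Data.List.Relation.Binary.Pointwise using (Pointwise-≡⇒≡)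
open import Data.List.Relation.Binary.Permutation.Propositional
  using (_↭_; ↭-sym; ↭-trans; ↭-reflexive; ↭⇒↭ₛ)
import Data.List.Relation.Binary.Permutation.Propositional.Properties as Perm
open import Data.List.Relation.Binary.Permutation.Setoid.Properties using (Unique-resp-↭)
open import Data.List.Relation.Binary.Sublist.Propositional using (⊆-refl)
open import Data.List.Relation.Binary.Sublist.Propositional.Properties using (filter⁺; length-mono-≤)
open import Data.Product using (_×_; _,_; proj₁; proj₂; ∃-syntax; ∃₂)
import Data.Product as Product
open import Data.Sum using (_⊎_; inj₁; inj₂)
import Data.Sum as Sum
open import Relation.Binary.PropositionalEquality
  using (_≡_; _≢_; refl; sym; trans; cong; cong₂; subst; subst₂; setoid; module ≡-Reasoning)

module _ {A : Set} where

  take-length-++ : (xs ys : List A) → take (length xs) (xs ++ ys) ≡ xs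
  take-length-++ []       ys = refl
  take-length-++ (x ∷ xs) ys = cong (x ∷_) (take-length-++ xs ys)

  drop-length-++ : (xs ys : List A) → drop (length xs) (xs ++ ys) ≡ ys
  drop-length-++ []       ys = refl
  drop-length-++ (x ∷ xs) ys = drop-length-++ xs ys

  take++take-drop++drop≡id : ∀ {i j} → i ≤ j → (xs : List A) →
    take i xs ++ take (j ∸ i) (drop i xs) ++ drop j xs ≡ xs
  take++take-drop++drop≡id {i} {j} i≤j xs = begin
    take i xs ++ take (j ∸ i) (drop i xs) ++ drop j xs
      ≡⟨ cong (λ ys → take i xs ++ take (j ∸ i) (drop i xs) ++ ys) drop-drop-j ⟨
    take i xs ++ take (j ∸ i) (drop i xs) ++ drop (j ∸ i) (drop i xs)
      ≡⟨ cong (take i xs ++_) (take++drop≡id (j ∸ i) (drop i xs)) ⟩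
    take i xs ++ drop i xs
      ≡⟨ take++drop≡id i xs ⟩
    xs ∎
    where
    open ≡-Reasoning
    drop-drop-j : drop (j ∸ i) (drop i xs) ≡ drop j xs
    drop-drop-j = trans (drop-drop i (j ∸ i) xs) (cong (λ k → drop k xs) (m+[n∸m]≡n i≤j))

  concat-++-++ : (xss yss zss : List (List A)) →
    concat xss ++ concat yss ++ concat zss ≡ concat (xss ++ yss ++ zss)
  concat-++-++ xss yss zss = trans (cong (concat xss ++_) (concat-++ yss zss)) (concat-++ xss (yss ++ zss))

  concat-reverse-map-reverse : (xss : List (List A)) → concat (reverse (map reverse xss)) ≡ reverse (concat xss)
  concat-reverse-map-reverse [] = refl
  concat-reverse-map-reverse (xs ∷ xss) = begin
    concat (reverse (reverse xs ∷ map reverse xss))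
      ≡⟨ cong concat (unfold-reverse (reverse xs) (map reverse xss)) ⟩
    concat (reverse (map reverse xss) ++ [ reverse xs ])
      ≡⟨ concat-++ (reverse (map reverse xss)) [ reverse xs ] ⟨
    concat (reverse (map reverse xss)) ++ reverse xs ++ []
      ≡⟨ cong₂ _++_ (concat-reverse-map-reverse xss) (++-identityʳ (reverse xs)) ⟩
    reverse (concat xss) ++ reverse xs
      ≡⟨ reverse-++ xs (concat xss) ⟨
    reverse (xs ++ concat xss) ∎
    where open ≡-Reasoning

  applyUpTo-cong : {f g : ℕ → A} (n : ℕ) → (∀ i → f i ≡ g i) → applyUpTo f n ≡ applyUpTo g n
  applyUpTo-cong zero    f≗g = refl
  applyUpTo-cong (suc n) f≗g = cong₂ _∷_ (f≗g 0) (applyUpTo-cong n (f≗g ∘ suc))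

  last-applyUpTo : (f : ℕ → A) (n : ℕ) → last (applyUpTo f (suc n)) ≡ just (f n)
  last-applyUpTo f zero    = refl
  last-applyUpTo f (suc n) = last-applyUpTo (f ∘ suc) n

  Unique-++-disjoint : (xs : List A) {ys : List A} {x : A} → Unique (xs ++ ys) → x ∈ xs → x ∈ ys → ⊥
  Unique-++-disjoint (_ ∷ xs) (x∉ ∷ _)      (here refl)  x∈ys = All.lookup (All.++⁻ʳ xs x∉) x∈ys refl
  Unique-++-disjoint (_ ∷ xs) (_ ∷ unique) (there x∈xs) x∈ys = Unique-++-disjoint xs unique x∈xs x∈ys

  Unique-++⁻ʳ : (xs : List A) {ys : List A} → Unique (xs ++ ys) → Unique ys
  Unique-++⁻ʳ xs {ys} unique = subst Unique (drop-length-++ xs ys) (Unique.drop⁺ (length xs) unique)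

foldr-⊓-least : ∀ {a x} ys → a ∈ x ∷ ys → All (a ≤_) (x ∷ ys) → foldr _⊓_ x ys ≡ a
foldr-⊓-least {a} {x} ys a∈ (a≤x ∷ a≤ys) =
  ≤-antisym (foldr-preservesᵒ ⊓-≤a x ys (≤a a∈)) (foldr-preservesᵇ ⊓-glb a≤x a≤ys)
  where
  ⊓-≤a : ∀ u v → u ≤ a ⊎ v ≤ a → u ⊓ v ≤ a
  ⊓-≤a u v = Sum.[ m≤n⇒m⊓o≤n v , m≤n⇒o⊓m≤n u ]
  ≤a : ∀ {y zs} → a ∈ y ∷ zs → y ≤ a ⊎ Any (_≤ a) zs
  ≤a (here refl)  = inj₁ ≤-refl
  ≤a (there a∈zs) = inj₂ (Any.map (λ { refl → ≤-refl }) a∈zs)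

module _ {A : Set} where

  revSeg-++ : (f : A → A) (xs ys zs : List A) →
    revSeg f (length xs) (length xs + length ys) (xs ++ ys ++ zs) ≡ xs ++ reverse (map f ys) ++ zs
  revSeg-++ f xs ys zs
    rewrite m+n∸m≡n (length xs) (length ys)
          | sym (drop-drop (length xs) (length ys) (xs ++ ys ++ zs))
          | take-length-++ xs (ys ++ zs) | drop-length-++ xs (ys ++ zs)
          | take-length-++ ys zs | drop-length-++ ys zs = refl

  revSeg-↭ : ∀ {i j} → i ≤ j → (xs : List A) → revSeg id i j xs ↭ xs
  revSeg-↭ {i} {j} i≤j xs rewrite map-id (take (j ∸ i) (drop i xs)) =
    ↭-trans (Perm.++⁺ˡ (take i xs) (Perm.++⁺ʳ (drop j xs) (Perm.↭-reverse (take (j ∸ i) (drop i xs)))))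
            (↭-reflexive (take++take-drop++drop≡id i≤j xs))

  All-revSeg : {P : A → Set} (f : A → A) → (∀ {x} → P x → P (f x)) →
    (i j : ℕ) {xs : List A} → All P xs → All P (revSeg f i j xs)
  All-revSeg f Pf i j Pxs =
    All.++⁺ (All.take⁺ i Pxs)
      (All.++⁺ (Perm.All-resp-↭ (↭-sym (Perm.↭-reverse _)) (All.gmap⁺ Pf (All.take⁺ (j ∸ i) (All.drop⁺ i Pxs))))
               (All.drop⁺ j Pxs))

map-revSeg : {A B : Set} (g : A → B) (f : A → A) (f′ : B → B) → (∀ x → g (f x) ≡ f′ (g x)) →
  (i j : ℕ) (xs : List A) → map g (revSeg f i j xs) ≡ revSeg f′ i j (map g xs)
map-revSeg {A} g f f′ g∘f≗f′∘g i j xs = begin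
  map g (take i xs ++ reverse (map f middle) ++ drop j xs)
    ≡⟨ map-++ g (take i xs) _ ⟩
  map g (take i xs) ++ map g (reverse (map f middle) ++ drop j xs)
    ≡⟨ cong (map g (take i xs) ++_) (map-++ g (reverse (map f middle)) (drop j xs)) ⟩
  map g (take i xs) ++ map g (reverse (map f middle)) ++ map g (drop j xs)
    ≡⟨ cong (λ ys → map g (take i xs) ++ ys ++ map g (drop j xs)) (reverse-map g (map f middle)) ⟩
  map g (take i xs) ++ reverse (map g (map f middle)) ++ map g (drop j xs)
    ≡⟨ cong (λ ys → map g (take i xs) ++ reverse ys ++ map g (drop j xs)) map-g-map-f ⟩
  map g (take i xs) ++ reverse (map f′ (map g middle)) ++ map g (drop j xs)
    ≡⟨ cong₂ (λ ys zs → ys ++ reverse (map f′ (map g middle)) ++ zs) (take-map i xs) (drop-map j xs) ⟨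
  take i (map g xs) ++ reverse (map f′ (map g middle)) ++ drop j (map g xs)
    ≡⟨ cong (λ ys → take i (map g xs) ++ reverse (map f′ ys) ++ drop j (map g xs)) map-g-middle ⟩
  revSeg f′ i j (map g xs) ∎
  where
  open ≡-Reasoning
  middle : List A
  middle = take (j ∸ i) (drop i xs)
  map-g-map-f : map g (map f middle) ≡ map f′ (map g middle)
  map-g-map-f = trans (sym (map-∘ middle)) (trans (map-cong g∘f≗f′∘g middle) (map-∘ middle))
  map-g-middle : map g middle ≡ take (j ∸ i) (drop i (map g xs))
  map-g-middle = sym (trans (cong (take (j ∸ i)) (drop-map i xs)) (take-map (j ∸ i) (drop i xs)))

Rev-++ : (xs ys zs : List ℕ) → Rev (xs ++ ys ++ zs) (xs ++ reverse ys ++ zs)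
Rev-++ xs ys zs = length xs , length xs + length ys , m≤m+n (length xs) (length ys) , bound , sym reversed
  where
  bound : length xs + length ys ≤ length (xs ++ ys ++ zs)
  bound rewrite length-++ xs {ys ++ zs} | length-++ ys {zs} =
    +-monoʳ-≤ (length xs) (m≤m+n (length ys) (length zs))
  reversed : revSeg id (length xs) (length xs + length ys) (xs ++ ys ++ zs) ≡ xs ++ reverse ys ++ zs
  reversed = trans (revSeg-++ id xs ys zs) (cong (λ ws → xs ++ reverse ws ++ zs) (map-id ys))

Rev⇒↭ : {xs ys : List ℕ} → Rev xs ys → ys ↭ xs
Rev⇒↭ {xs} (_ , _ , i≤j , _ , refl) = revSeg-↭ i≤j xs

Rev-concat-revSeg : (xss : List (List ℕ)) {i j : ℕ} → i ≤ j →
  Rev (concat xss) (concat (revSeg reverse i j xss))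
Rev-concat-revSeg xss {i} {j} i≤j = subst₂ Rev before after (Rev-++ (concat yss) (concat zss) (concat wss))
  where
  yss zss wss : List (List ℕ)
  yss = take i xss
  zss = take (j ∸ i) (drop i xss)
  wss = drop j xss
  before : concat yss ++ concat zss ++ concat wss ≡ concat xss
  before = trans (concat-++-++ yss zss wss) (cong concat (take++take-drop++drop≡id i≤j xss))
  after : concat yss ++ reverse (concat zss) ++ concat wss ≡ concat (revSeg reverse i j xss)
  after = trans (cong (λ us → concat yss ++ us ++ concat wss) (sym (concat-reverse-map-reverse zss)))
                (concat-++-++ yss (reverse (map reverse zss)) wss)

data Strip (a : ℕ) : Deco → List ℕ → Set where
  single     : Strip a dot [ a ]
  increasing : ∀ n → Strip a plus  (applyUpTo (_+ a) (2 + n))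
  decreasing : ∀ n → Strip a minus (applyDownFrom (_+ a) (2 + n))

Strip-reverse : ∀ {a d s} → Strip a d s → Strip a (flipD d) (reverse s)
Strip-reverse single = single
Strip-reverse {a} (increasing n) =
  subst (Strip a minus) (sym (reverse-applyUpTo (_+ a) (2 + n))) (decreasing n)
Strip-reverse {a} (decreasing n) =
  subst (Strip a plus) (sym (reverse-applyDownFrom (_+ a) (2 + n))) (increasing n)

n<ᵇ1+n : ∀ n → (n <ᵇ suc n) ≡ true
n<ᵇ1+n zero    = refl
n<ᵇ1+n (suc n) = n<ᵇ1+n n

1+n<ᵇn : ∀ n → (suc n <ᵇ n) ≡ false
1+n<ᵇn zero    = refl
1+n<ᵇn (suc n) = 1+n<ᵇn n

stripInfo-Strip : ∀ {a d s} → Strip a d s → stripInfo s ≡ (a , d)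
stripInfo-Strip single = refl
stripInfo-Strip {a} (increasing n) rewrite n<ᵇ1+n a =
  cong (_, plus) (foldr-⊓-least _ (here refl) (All.applyUpTo⁺₂ (_+ a) (2 + n) (λ i → m≤n+m a i)))
stripInfo-Strip {a} (decreasing n) rewrite 1+n<ᵇn (n + a) =
  cong (_, minus) (foldr-⊓-least _ (∈-applyDownFrom⁺ (_+ a) (s≤s z≤n))
    (All.applyDownFrom⁺₂ (_+ a) (2 + n) (λ i → m≤n+m a i)))

extends-single : ∀ x y → T (extends x [ y ]) → suc x ≡ y ⊎ x ≡ suc y
extends-single x y = Sum.map (≡ᵇ⇒≡ _ _) (≡ᵇ⇒≡ _ _) ∘ Equivalence.to T-∨

extends-cons : ∀ x y z zs → T (extends x (y ∷ z ∷ zs)) → (suc x ≡ y × suc y ≡ z) ⊎ (x ≡ suc y × y ≡ suc z)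
extends-cons x y z zs = Sum.map both both ∘ Equivalence.to T-∨
  where
  both : ∀ {m n p q} → T ((m ≡ᵇ n) ∧ (p ≡ᵇ q)) → m ≡ n × p ≡ q
  both = Product.map (≡ᵇ⇒≡ _ _) (≡ᵇ⇒≡ _ _) ∘ Equivalence.to T-∧

Strip-extends : ∀ {a d s} x → Strip a d s → T (extends x s) → ∃₂ λ a′ d′ → Strip a′ d′ (x ∷ s)
Strip-extends {a} x single t with extends-single x a t
... | inj₁ refl = x , plus , increasing 0
... | inj₂ refl = a , minus , decreasing 0
Strip-extends {a} {s = _ ∷ _ ∷ zs} x (increasing n) t with extends-cons x a (suc a) zs t
... | inj₁ (refl , _) =
  x , plus , subst (Strip x plus) (cong (x ∷_) (sym (applyUpTo-cong (2 + n) (λ i → +-suc i x)))) (increasing (suc n))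
... | inj₂ (_ , a≡2+a) = ⊥-elim (m≢1+n+m a {1} a≡2+a)
Strip-extends {a} {s = _ ∷ _ ∷ zs} x (decreasing n) t with extends-cons x (suc n + a) (n + a) zs t
... | inj₁ (_ , 2+n+a≡n+a) = ⊥-elim (m≢1+n+m (n + a) {1} (sym 2+n+a≡n+a))
... | inj₂ (refl , _) = a , minus , decreasing (suc n)

strips-Strip : ∀ xs → All (λ s → ∃₂ λ a d → Strip a d s) (strips xs)
strips-Strip [] = []
strips-Strip (x ∷ xs) with strips xs | strips-Strip xs
... | []     | _ = (x , dot , single) ∷ []
... | s ∷ ss | (a , d , strip) ∷ rest with extends x s in extends≡true
...   | true  = Strip-extends x strip (Equivalence.from T-≡ extends≡true) ∷ rest
...   | false = (x , dot , single) ∷ (a , d , strip) ∷ rest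

concat-strips : ∀ xs → concat (strips xs) ≡ xs
concat-strips [] = refl
concat-strips (x ∷ xs) with strips xs | concat-strips xs
... | []     | concat≡xs = cong (x ∷_) concat≡xs
... | s ∷ ss | concat≡xs with extends x s
...   | true  = cong (x ∷_) concat≡xs
...   | false = cong (x ∷_) concat≡xs

rank-mono-≤ : ∀ vs {x y} → x ≤ y → rank vs x ≤ rank vs y
rank-mono-≤ vs {x} {y} x≤y =
  s≤s (length-mono-≤ (filter⁺ (_<? x) (_<? y) (λ { refl v<x → <-≤-trans v<x x≤y }) (⊆-refl {x = vs})))

rank-reflects-< : ∀ vs {x y} → rank vs x < rank vs y → x < y
rank-reflects-< vs r = ≰⇒> (λ y≤x → <⇒≱ r (rank-mono-≤ vs y≤x))

-- Blocks: factors of a permutation paired with the peg entries standing for them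

Block : Set
Block = List ℕ × (ℕ × Deco)

flipBlock : Block → Block
flipBlock (s , e) = reverse s , flipE e

stripBlock : (ℕ → ℕ) → List ℕ → Block
stripBlock r s = s , Product.map₁ r (stripInfo s)

Labelled : (ℕ → ℕ) → Block → Set
Labelled r (s , v , d) = ∃[ a ] v ≡ r a × Strip a d s

Labelled-flip : ∀ r {z} → Labelled r z → Labelled r (flipBlock z)
Labelled-flip r (a , v≡ra , strip) = a , v≡ra , Strip-reverse strip

Labelled-stripBlock : ∀ r {a d s} → Strip a d s → Labelled r (stripBlock r s)
Labelled-stripBlock r strip rewrite stripInfo-Strip strip = _ , refl , strip

run : ℕ × ℕ → List ℕ
run (a , l) = applyUpTo (_+ a) (suc l)

∈-run : ∀ {a b} l → a ≤ b → b ≤ l + a → b ∈ run (a , l)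
∈-run {a} {b} l a≤b b≤l+a = subst (_∈ run (a , l)) (m∸n+n≡m a≤b)
  (∈-applyUpTo⁺ (_+ a) (s≤s (m≤n+o⇒m∸n≤o b a (subst (b ≤_) (+-comm l a) b≤l+a))))

Strip⇒run : ∀ {a d s} → Strip a d s → d ≢ minus → ∃[ l ] s ≡ run (a , l)
Strip⇒run single         _       = 0 , refl
Strip⇒run (increasing n) _       = suc n , refl
Strip⇒run (decreasing n) d≢minus = ⊥-elim (d≢minus refl)

-- The next run starts at some b > a; were b ≤ l + a, then b would lie in both runs.
run-joins : ∀ {a l rs} → Linked (_<_ on proj₁) ((a , l) ∷ rs) → Unique (run (a , l) ++ concat (map run rs)) →
  Connected _≤_ (just (l + a)) (head (concat (map run rs)))
run-joins {rs = []} _ _ = Connected.just-nothing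
run-joins {a} {l} {(b , _) ∷ _} (a<b ∷ _) unique = Connected.just (≮⇒≥ λ b<l+a →
  Unique-++-disjoint (run (a , l)) unique (∈-run l (<⇒≤ a<b) (<⇒≤ b<l+a)) (here refl))

Linked-concat-runs : ∀ {rs} → Linked (_<_ on proj₁) rs → Unique (concat (map run rs)) →
  Linked _≤_ (concat (map run rs))
Linked-concat-runs {[]} _ _ = []
Linked-concat-runs {(a , l) ∷ rs} sorted unique =
  Linked.++⁺ (Linked.applyUpTo⁺₂ (_+ a) (suc l) (λ i → n≤1+n (i + a)))
             (subst (λ m → Connected _≤_ m (head (concat (map run rs))))
                    (sym (last-applyUpTo (_+ a) l)) (run-joins sorted unique))
             (Linked-concat-runs (Linked.tail sorted) (Unique-++⁻ʳ (run (a , l)) unique))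

runs-of-Labelled : ∀ r zs → All (Labelled r) zs → All (λ z → proj₂ (proj₂ z) ≢ minus) zs →
  ∃[ rs ] concat (map proj₁ zs) ≡ concat (map run rs) × map (r ∘ proj₁) rs ≡ map proj₁ (map proj₂ zs)
runs-of-Labelled r [] [] [] = [] , refl , refl
runs-of-Labelled r (_ ∷ zs) ((a , v≡ra , strip) ∷ labelled) (d≢minus ∷ notMinus)
  with Strip⇒run strip d≢minus | runs-of-Labelled r zs labelled notMinus
... | l , s≡run | rs , concat≡ , labels≡ = (a , l) ∷ rs , cong₂ _++_ s≡run concat≡ , cong₂ _∷_ (sym v≡ra) labels≡

ident-Linked : ∀ n → Linked _<_ (ident n)
ident-Linked n = Linked.map⁺ (Linked.applyUpTo⁺₂ id n (λ i → n<1+n (suc i)))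

ident-Unique : ∀ n → Unique (ident n)
ident-Unique n = Unique.map⁺ suc-injective (Unique.upTo⁺ n)

length-ident : ∀ n → length (ident n) ≡ n
length-ident n = trans (length-map suc (upTo n)) (length-upTo n)

PegSorted⇒concat≡ident : ∀ {r n} → (∀ {x y} → r x < r y → x < y) → (zs : List Block) → All (Labelled r) zs →
  PegSorted (map proj₂ zs) → concat (map proj₁ zs) ↭ ident n → concat (map proj₁ zs) ≡ ident n
PegSorted⇒concat≡ident {r} {n} r-reflects zs labelled (values≡ident , notMinus) perm
  with runs-of-Labelled r zs labelled (All.map⁻ notMinus)
... | rs , concat≡ , labels≡ =
  Pointwise-≡⇒≡ (↗↭↗⇒≋ ≤-totalOrder sorted (Linked.map <⇒≤ (ident-Linked n)) (↭⇒↭ₛ perm))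
  where
  starts-increasing : Linked (_<_ on proj₁) rs
  starts-increasing = Linked.map r-reflects (Linked.map⁻
    (subst (Linked _<_) (sym (trans labels≡ values≡ident)) (ident-Linked _)))
  unique : Unique (concat (map run rs))
  unique = subst Unique concat≡ (Unique-resp-↭ (setoid ℕ) (↭⇒↭ₛ (↭-sym perm)) (ident-Unique n))
  sorted : Linked _≤_ (concat (map proj₁ zs))
  sorted = subst (Linked _≤_) (sym concat≡) (Linked-concat-runs starts-increasing unique)

RdLe-concat-blocks : ∀ {r n k ps} → (∀ {x y} → r x < r y → x < y) → PegRdLe k ps →
  (zs : List Block) → map proj₂ zs ≡ ps → All (Labelled r) zs →
  concat (map proj₁ zs) ↭ ident n → RdLe k (concat (map proj₁ zs))
RdLe-concat-blocks {n = n} r-reflects (done sorted) zs refl labelled perm =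
  done (trans (PegSorted⇒concat≡ident r-reflects zs labelled sorted perm)
              (cong ident (sym (trans (Perm.↭-length perm) (length-ident n)))))
RdLe-concat-blocks {r} r-reflects (step (i , j , i≤j , _ , refl) rest) zs refl labelled perm =
  step reversal (RdLe-concat-blocks r-reflects rest zs′
    (map-revSeg proj₂ flipBlock flipE (λ _ → refl) i j zs)
    (All-revSeg flipBlock (Labelled-flip r) i j labelled)
    (↭-trans (Rev⇒↭ reversal) perm))
  where
  zs′ : List Block
  zs′ = revSeg flipBlock i j zs
  reversal : Rev (concat (map proj₁ zs)) (concat (map proj₁ zs′))
  reversal = subst (Rev _) (cong concat (sym (map-revSeg proj₁ flipBlock reverse (λ _ → refl) i j zs)))
                   (Rev-concat-revSeg (map proj₁ zs) i≤j)

mainTheorem20 : (π : List ℕ) → π ↭ ident (length π) →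
    (k : ℕ) → PegRdLe k (peg π) → RdLe k π
mainTheorem20 π π↭ident k pegRdLe =
  subst (RdLe k) concat≡π (RdLe-concat-blocks (rank-reflects-< values) pegRdLe blocks blocks≡peg labelled
    (subst (_↭ ident (length π)) (sym concat≡π) π↭ident))
  where
  values : List ℕ
  values = map proj₁ (map stripInfo (strips π))
  blocks : List Block
  blocks = map (stripBlock (rank values)) (strips π)
  blocks≡peg : map proj₂ blocks ≡ peg π
  blocks≡peg = trans (sym (map-∘ (strips π))) (map-∘ (strips π))
  concat≡π : concat (map proj₁ blocks) ≡ π
  concat≡π = trans (cong concat (trans (sym (map-∘ (strips π))) (map-id (strips π)))) (concat-strips π)
  labelled : All (Labelled (rank values)) blocks
  labelled = All.map⁺ (All.map (λ (_ , _ , strip) → Labelled-stripBlock (rank values) strip) (strips-Strip π))
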